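{- For any variety $\mathcal{V}$ of $\mathcal{L}$-algebras, the following are equivalent: (1) $\mathcal{V}$ has a guarded deduction theorem. (2) There exist conjunctions of equations $\gamma(x_1,x_2,y_1,y_2,\overline{z})$ and $\varphi(x_1,x_2,y_1,y_2,\overline{z})$ such that for every finitely generated $A\in\mathcal{V}$ and all $a_1,a_2,b_1,b_2\in A$: there is an embedding of $A$ into some member of $\mathcal{V}$ satisfying $\exists\overline{z}.\gamma(a_1,a_2,b_1,b_2,\overline{z})$; and $(a_1,a_2)\in\mathrm{Cg}^A(b_1,b_2)$ if and only if for every $B\in\mathcal{V}$ and every homomorphism $h\colon A\to B$, $B\models\forall\overline{z}.(\gamma\to\varphi)(h(a_1),h(a_2),h(b_1),h(b_2),\overline{z})$.
   Context: $\mathcal{L}$ is an algebraic first-order language (no relation symbols) with at least one constant symbol. $\mathcal{V}\models\alpha$ means all members satisfy the universal closure of $\alpha$. $\mathrm{Cg}^A(b_1,b_2)$ is the smallest congruence of $A$ containing $(b_1,b_2)$. $\mathcal{V}$ has a guarded deduction theorem if there are conjunctions of equations $\gamma(x_1,x_2,y_1,y_2,\overline{z})$ and $\varphi(x_1,x_2,y_1,y_2,\overline{z})$ such that for every finite set of variables $\overline{w}$ disjoint from $\overline{z}$, all terms $s_1,s_2,t_1,t_2$ in variables $\overline{w}$, and every conjunction of equations $\pi(\overline{w})$: (i) $\mathcal{V}\models(\pi\,\&\,t_1\approx t_2)\to s_1\approx s_2$ iff $\mathcal{V}\models\pi\to\forall\overline{z}.(\gamma\to\varphi)(s_1,s_2,t_1,t_2,\overline{z})$;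 and (ii) for every equation $\sigma(\overline{w})$, $\mathcal{V}\models(\pi\,\&\,\gamma(s_1,s_2,t_1,t_2,\overline{z}))\to\sigma$ iff $\mathcal{V}\models\pi\to\sigma$. Here $(\cdot)(s_1,s_2,t_1,t_2,\overline{z})$ means substituting $s_1,s_2,t_1,t_2$ for $x_1,x_2,y_1,y_2$. -}

module Defs where

open import Data.Nat using (ℕ; zero; suc)
open import Data.Fin using (Fin; zero; suc)
open import Data.Sum using (_⊎_; inj₁; inj₂; [_,_])
open import Data.Product using (_×_; _,_; Σ; ∃)
open import Data.List using (List; []; _∷_; map; _++_)
open import Data.List.Relation.Unary.All using (All)
open import Relation.Binary.PropositionalEquality using (_≡_)
open import Relation.Binary.Structures using (IsEquivalence)
open import Function.Bundles using (_⇔_)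

record Language : Set₁ where
  field
    Op : Set
    ar : Op → ℕ

open Language public

HasConstant : Language → Set
HasConstant L = Σ (Op L) λ c → ar L c ≡ 0

module _ (L : Language) where

  data Term (X : Set) : Set where
    var : X → Term X
    app : (o : Op L) → (Fin (ar L o) → Term X) → Term X

  Equation : Set → Set
  Equation X = Term X × Term X

  Conj : Set → Set
  Conj X = List (Equation X)

  substT : {X Y : Set} → (X → Term Y) → Term X → Term Y
  substT σ (var x) = σ x
  substT σ (app o ts) = app o (λ i → substT σ (ts i))

  substE : {X Y : Set} → (X → Term Y) → Equation X → Equation Y
  substE σ (s , t) = substT σ s , substT σ t

  substC : {X Y : Set} → (X → Term Y) → Conj X → Conj Y
  substC σ = map (substE σ)

  record Algebra : Set₁ where
    field
      Carrier : Set
      _≈_     : Carrier → Carrier → Set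
      isEquiv : IsEquivalence _≈_
      op      : (o : Op L) → (Fin (ar L o) → Carrier) → Carrier
      op-cong : (o : Op L) {a b : Fin (ar L o) → Carrier} →
                (∀ i → a i ≈ b i) → op o a ≈ op o b

  open Algebra public

  ⟦_⟧ : {X : Set} (A : Algebra) → Term X → (X → Carrier A) → Carrier A
  ⟦ A ⟧ (var x) ρ = ρ x
  ⟦ A ⟧ (app o ts) ρ = op A o (λ i → ⟦ A ⟧ (ts i) ρ)

  HoldsE : {X : Set} (A : Algebra) → (X → Carrier A) → Equation X → Set
  HoldsE A ρ (s , t) = _≈_ A (⟦ A ⟧ s ρ) (⟦ A ⟧ t ρ)

  Holds : {X : Set} (A : Algebra) → (X → Carrier A) → Conj X → Set
  Holds A ρ π = All (HoldsE A ρ) π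

  record Hom (A B : Algebra) : Set where
    field
      fun      : Carrier A → Carrier B
      fun-cong : ∀ {a b} → _≈_ A a b → _≈_ B (fun a) (fun b)
      fun-op   : (o : Op L) (a : Fin (ar L o) → Carrier A) →
                 _≈_ B (fun (op A o a)) (op B o (λ i → fun (a i)))

  open Hom public

  IsEmbedding : {A B : Algebra} → Hom A B → Set
  IsEmbedding {A} {B} h = ∀ {a b} → _≈_ B (fun h a) (fun h b) → _≈_ A a b

  record IsCongruence (A : Algebra) (θ : Carrier A → Carrier A → Set) : Set where
    field
      isEquivθ : IsEquivalence θ
      ≈⊆θ      : ∀ {a b} → _≈_ A a b → θ a b
      compat   : (o : Op L) {a b : Fin (ar L o) → Carrier A} →
                 (∀ i → θ (a i) (b i)) → θ (op A o a) (op A o b)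

  -- (a₁ , a₂) ∈ Cg^A(b₁ , b₂): the smallest congruence containing (b₁ , b₂)
  Cg : (A : Algebra) → Carrier A → Carrier A → Carrier A → Carrier A → Set₁
  Cg A b₁ b₂ a₁ a₂ =
    (θ : Carrier A → Carrier A → Set) → IsCongruence A θ → θ b₁ b₂ → θ a₁ a₂

  FinitelyGenerated : Algebra → Set
  FinitelyGenerated A =
    Σ ℕ λ n → Σ (Fin n → Carrier A) λ g →
      (a : Carrier A) → Σ (Term (Fin n)) λ t → _≈_ A a (⟦ A ⟧ t g)

  record Variety : Set₁ where
    field
      Axioms : Equation ℕ → Set

  open Variety public

  _∈V_ : Algebra → Variety → Set
  A ∈V V = (e : Equation ℕ) → Axioms V e → (ρ : ℕ → Carrier A) → HoldsE A ρ e

  _⊨_⇒_ : {X : Set} → Variety → Conj X → Conj X → Set₁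
  _⊨_⇒_ {X} V π ψ =
    (A : Algebra) → A ∈V V → (ρ : X → Carrier A) → Holds A ρ π → Holds A ρ ψ

  -- Formulas γ(x₁,x₂,y₁,y₂,z̄): variables  Fin 4 ⊎ Fin k
  -- (inj₁ 0,1,2,3 = x₁,x₂,y₁,y₂ ; inj₂ j = z_j)

  four : {A : Set} → A → A → A → A → Fin 4 → A
  four a b c d zero = a
  four a b c d (suc zero) = b
  four a b c d (suc (suc zero)) = c
  four a b c d (suc (suc (suc zero))) = d

  inst : {n k : ℕ} → Term (Fin n) → Term (Fin n) → Term (Fin n) → Term (Fin n) →
         Conj (Fin 4 ⊎ Fin k) → Conj (Fin n ⊎ Fin k)
  inst s₁ s₂ t₁ t₂ γ =
    substC [ (λ i → substT (λ w → var (inj₁ w)) (four s₁ s₂ t₁ t₂ i)) , (λ j → var (inj₂ j)) ] γ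

  liftC : {n k : ℕ} → Conj (Fin n) → Conj (Fin n ⊎ Fin k)
  liftC = substC (λ w → var (inj₁ w))

  GuardedDeductionTheorem : Variety → Set₁
  GuardedDeductionTheorem V =
    Σ ℕ λ k → Σ (Conj (Fin 4 ⊎ Fin k)) λ γ → Σ (Conj (Fin 4 ⊎ Fin k)) λ φ →
      (n : ℕ) (s₁ s₂ t₁ t₂ : Term (Fin n)) (π : Conj (Fin n)) →
        ( (V ⊨ (π ++ ((t₁ , t₂) ∷ [])) ⇒ ((s₁ , s₂) ∷ []))
          ⇔ ((A : Algebra) → A ∈V V → (ρ : Fin n → Carrier A) → Holds A ρ π →
               (ζ : Fin k → Carrier A) →
               Holds A [ ρ , ζ ] (inst s₁ s₂ t₁ t₂ γ) →
               Holds A [ ρ , ζ ] (inst s₁ s₂ t₁ t₂ φ)) )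
        ×
        ( (σ : Equation (Fin n)) →
            (V ⊨ (liftC {n} {k} π ++ inst s₁ s₂ t₁ t₂ γ) ⇒ liftC (σ ∷ []))
            ⇔ (V ⊨ π ⇒ (σ ∷ [])) )

  Condition2 : Variety → Set₁
  Condition2 V =
    Σ ℕ λ k → Σ (Conj (Fin 4 ⊎ Fin k)) λ γ → Σ (Conj (Fin 4 ⊎ Fin k)) λ φ →
      (A : Algebra) → A ∈V V → FinitelyGenerated A →
      (a₁ a₂ b₁ b₂ : Carrier A) →
        ( Σ Algebra λ B → B ∈V V × Σ (Hom A B) λ e → IsEmbedding {A} {B} e ×
            Σ (Fin k → Carrier B) λ ζ →
              Holds B [ four (fun e a₁) (fun e a₂) (fun e b₁) (fun e b₂) , ζ ] γ )
        ×
        ( Cg A b₁ b₂ a₁ a₂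
          ⇔ ((B : Algebra) → B ∈V V → (h : Hom A B) → (ζ : Fin k → Carrier B) →
               Holds B [ four (fun h a₁) (fun h a₂) (fun h b₁) (fun h b₂) , ζ ] γ →
               Holds B [ four (fun h a₁) (fun h a₂) (fun h b₁) (fun h b₂) , ζ ] φ) )

{-# OPTIONS --safe #-}

-- Both directions are read off term models. The principal congruences of the term model
-- F(w̄)/H are given by derivability: (s₁,s₂) ∈ Cg(t₁,t₂) iff H & t₁≈t₂ ⊢ s₁≈s₂, and a
-- derivation uses only finitely many hypotheses.
--
-- (2) ⇒ (1): apply (2) to the finitely presented algebra F(w̄)/π. Its homomorphisms are the
-- assignments satisfying π, so the characterisation of Cg(t₁,t₂) in (2) is clause (i); and
-- since F(w̄)/π embeds into a model of ∃z̄.γ(s̄,t̄,z̄), adding γ proves no new equations, (ii).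
--
-- (1) ⇒ (2): a finitely generated A is isomorphic to F(w̄)/D for its diagram D, and (2) is
-- invariant under isomorphism. Adjoining to F(w̄)/D new generators z̄ subject to γ(s̄,t̄,z̄)
-- gives the required extension: by compactness and (ii) it identifies no two elements of
-- F(w̄)/D. By compactness and (i), (s₁,s₂) ∈ Cg(t₁,t₂) makes γ → φ valid under some finite
-- π ⊆ D, hence in every homomorphic image. Conversely, validity in the extension itself, where
-- z̄ is generic, yields a derivation of φ(s̄,t̄,z̄) from finitely many equations of D and γ,
-- which (i) turns back into (s₁,s₂) ∈ Cg(t₁,t₂).
module Submission where

open import Data.Fin using (Fin; zero; suc)
open import Data.List using (List; []; _∷_; _++_; map)
open import Data.List.Membership.Propositional using (_∈_)
open import Data.List.Membership.Propositional.Properties using (∈-++⁺ˡ; ∈-++⁺ʳ; ∈-++⁻)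
open import Data.List.Relation.Unary.All as All using (All; []; _∷_)
open import Data.List.Relation.Unary.All.Properties using (++⁺; ++⁻ˡ; map⁺; map⁻; anti-mono)
open import Data.List.Relation.Unary.Any using (here; there)
open import Data.Nat using (ℕ; zero; suc)
open import Data.Product using (Σ; ∃; _×_; _,_; proj₁; proj₂; uncurry)
open import Data.Sum using (_⊎_; inj₁; inj₂; [_,_]; map₁)
open import Function using (_∘_)
open import Function.Bundles using (_⇔_; mk⇔; Equivalence)
open import Function.Construct.Composition using (_⇔-∘_)
open import Function.Construct.Symmetry using (⇔-sym)
open import Function.Related.Propositional using (module EquationalReasoning)
open import Level using (0ℓ)
open import Relation.Binary.PropositionalEquality using (_≡_; refl; cong; subst)
open import Relation.Binary.Structures using (IsEquivalence)
open import Relation.Unary using (Pred; _⊆_; _∪_)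

open import Defs

open Equivalence using (to; from)

All-∪-split : {A : Set} {P : Pred A 0ℓ} {Γ π : List A} →
              All (P ∪ (_∈ Γ)) π → ∃ λ π₀ → All P π₀ × (_∈ π) ⊆ (_∈ π₀ ++ Γ)
All-∪-split [] = [] , [] , λ ()
All-∪-split (inj₁ p ∷ ps) with All-∪-split ps
... | π₀ , p₀ , π⊆ = _ ∷ π₀ , p ∷ p₀ , λ { (here refl) → here refl ; (there m) → there (π⊆ m) }
All-∪-split (inj₂ m ∷ ps) with All-∪-split ps
... | π₀ , p₀ , π⊆ = π₀ , p₀ , λ { (here refl) → ∈-++⁺ʳ π₀ m ; (there m′) → π⊆ m′ }

All-preimage : {A B : Set} {P : Pred A 0ℓ} {f : A → B} {ys : List B} →
               All (λ y → ∃ λ x → P x × y ≡ f x) ys → ∃ λ xs → All P xs × ys ≡ map f xs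
All-preimage [] = [] , [] , refl
All-preimage {f = f} ((x , p , refl) ∷ ps) with All-preimage ps
... | xs , p₀ , ys≡ = x ∷ xs , p ∷ p₀ , cong (f x ∷_) ys≡

module _ (L : Language) where

  ≈-syntax : (C : Algebra L) → Carrier C → Carrier C → Set
  ≈-syntax = _≈_

  syntax ≈-syntax C a b = a ≈[ C ] b

  module _ (C : Algebra L) where
    open IsEquivalence (isEquiv C) public
      using () renaming (refl to ≈-refl; sym to ≈-sym; trans to ≈-trans)

  eval : {X : Set} (C : Algebra L) → Term L X → (X → Carrier C) → Carrier C
  eval = ⟦_⟧ L

  eval-cong : {X : Set} (C : Algebra L) (t : Term L X) {ρ ρ′ : X → Carrier C} →
              (∀ x → ρ x ≈[ C ] ρ′ x) → eval C t ρ ≈[ C ] eval C t ρ′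
  eval-cong C (var x) ρ≈ρ′ = ρ≈ρ′ x
  eval-cong C (app o ts) ρ≈ρ′ = op-cong C o (λ i → eval-cong C (ts i) ρ≈ρ′)

  eval-substT : {X Y : Set} (C : Algebra L) (σ : X → Term L Y) (ρ : Y → Carrier C)
                (t : Term L X) → eval C (substT L σ t) ρ ≈[ C ] eval C t (λ x → eval C (σ x) ρ)
  eval-substT C σ ρ (var x) = ≈-refl C
  eval-substT C σ ρ (app o ts) = op-cong C o (λ i → eval-substT C σ ρ (ts i))

  eval-hom : {X : Set} {C D : Algebra L} (h : Hom L C D) (t : Term L X) (ρ : X → Carrier C) →
             eval D t (fun h ∘ ρ) ≈[ D ] fun h (eval C t ρ)
  eval-hom {D = D} h (var x) ρ = ≈-refl D
  eval-hom {C = C} {D} h (app o ts) ρ =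
    ≈-trans D (op-cong D o (λ i → eval-hom h (ts i) ρ))
              (≈-sym D (fun-op h o (λ i → eval C (ts i) ρ)))

  Holds-cong : {X : Set} (C : Algebra L) {ρ ρ′ : X → Carrier C} (π : Conj L X) →
               (∀ x → ρ x ≈[ C ] ρ′ x) → Holds L C ρ π ⇔ Holds L C ρ′ π
  Holds-cong C π ρ≈ρ′ =
    mk⇔ (All.map (λ {e} → transport ρ≈ρ′ {e})) (All.map (λ {e} → transport (≈-sym C ∘ ρ≈ρ′) {e}))
    where
      transport : ∀ {ρ ρ′} → (∀ x → ρ x ≈[ C ] ρ′ x) → HoldsE L C ρ ⊆ HoldsE L C ρ′
      transport ρ≈ρ′ {l , r} l≈r =
        ≈-trans C (≈-sym C (eval-cong C l ρ≈ρ′)) (≈-trans C l≈r (eval-cong C r ρ≈ρ′))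

  Holds-substC : {X Y : Set} (C : Algebra L) (σ : X → Term L Y) (ρ : Y → Carrier C)
                 (π : Conj L X) → Holds L C ρ (substC L σ π) ⇔ Holds L C (λ x → eval C (σ x) ρ) π
  Holds-substC C σ ρ π =
    mk⇔ (All.map (λ {e} → substituted {e}) ∘ map⁻) (map⁺ ∘ All.map (λ {e} → unsubstituted {e}))
    where
      substituted : HoldsE L C ρ ∘ substE L σ ⊆ HoldsE L C (λ x → eval C (σ x) ρ)
      substituted {l , r} l≈r =
        ≈-trans C (≈-sym C (eval-substT C σ ρ l)) (≈-trans C l≈r (eval-substT C σ ρ r))
      unsubstituted : HoldsE L C (λ x → eval C (σ x) ρ) ⊆ HoldsE L C ρ ∘ substE L σ
      unsubstituted {l , r} l≈r =
        ≈-trans C (eval-substT C σ ρ l) (≈-trans C l≈r (≈-sym C (eval-substT C σ ρ r)))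

  Holds-liftC : {n k : ℕ} (C : Algebra L) (ρ : Fin n ⊎ Fin k → Carrier C) (π : Conj L (Fin n)) →
                Holds L C ρ (liftC L π) ⇔ Holds L C (ρ ∘ inj₁) π
  Holds-liftC C ρ = Holds-substC C (λ w → var (inj₁ w)) ρ

  instSubst : {n k : ℕ} → (s₁ s₂ t₁ t₂ : Term L (Fin n)) → Fin 4 ⊎ Fin k → Term L (Fin n ⊎ Fin k)
  instSubst s₁ s₂ t₁ t₂ =
    [ (λ i → substT L (λ w → var (inj₁ w)) (four L s₁ s₂ t₁ t₂ i)) , (λ j → var (inj₂ j)) ]

  Holds-inst : {n k : ℕ} (C : Algebra L) (s₁ s₂ t₁ t₂ : Term L (Fin n))
               {ρ : Fin n → Carrier C} {ζ : Fin k → Carrier C} {c₁ c₂ c₃ c₄ : Carrier C} →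
               eval C s₁ ρ ≈[ C ] c₁ → eval C s₂ ρ ≈[ C ] c₂ →
               eval C t₁ ρ ≈[ C ] c₃ → eval C t₂ ρ ≈[ C ] c₄ → (ψ : Conj L (Fin 4 ⊎ Fin k)) →
               Holds L C [ ρ , ζ ] (inst L s₁ s₂ t₁ t₂ ψ) ⇔ Holds L C [ four L c₁ c₂ c₃ c₄ , ζ ] ψ
  Holds-inst C s₁ s₂ t₁ t₂ {ρ} {ζ} {c₁} {c₂} {c₃} {c₄} p₁ p₂ p₃ p₄ ψ =
    Holds-cong C ψ instantiated ⇔-∘ Holds-substC C (instSubst s₁ s₂ t₁ t₂) [ ρ , ζ ] ψ
    where
      lifted : ∀ t → eval C (substT L (λ w → var (inj₁ w)) t) [ ρ , ζ ] ≈[ C ] eval C t ρ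
      lifted = eval-substT C _ [ ρ , ζ ]
      instantiated : ∀ x → eval C (instSubst s₁ s₂ t₁ t₂ x) [ ρ , ζ ] ≈[ C ] [ four L c₁ c₂ c₃ c₄ , ζ ] x
      instantiated (inj₁ zero) = ≈-trans C (lifted s₁) p₁
      instantiated (inj₁ (suc zero)) = ≈-trans C (lifted s₂) p₂
      instantiated (inj₁ (suc (suc zero))) = ≈-trans C (lifted t₁) p₃
      instantiated (inj₁ (suc (suc (suc zero)))) = ≈-trans C (lifted t₂) p₄
      instantiated (inj₂ j) = ≈-refl C

  Holds-inst-eval : {n k : ℕ} (C : Algebra L) {s₁ s₂ t₁ t₂ : Term L (Fin n)}
                    {ρ : Fin n → Carrier C} {ζ : Fin k → Carrier C} (ψ : Conj L (Fin 4 ⊎ Fin k)) →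
                    Holds L C [ ρ , ζ ] (inst L s₁ s₂ t₁ t₂ ψ) ⇔
                    Holds L C [ four L (eval C s₁ ρ) (eval C s₂ ρ) (eval C t₁ ρ) (eval C t₂ ρ) , ζ ] ψ
  Holds-inst-eval C {s₁} {s₂} {t₁} {t₂} =
    Holds-inst C s₁ s₂ t₁ t₂ (≈-refl C) (≈-refl C) (≈-refl C) (≈-refl C)

  Holds-four-cong : {k : ℕ} (C : Algebra L) {ζ : Fin k → Carrier C}
                    {a₁ a₂ a₃ a₄ b₁ b₂ b₃ b₄ : Carrier C} →
                    a₁ ≈[ C ] b₁ → a₂ ≈[ C ] b₂ → a₃ ≈[ C ] b₃ → a₄ ≈[ C ] b₄ →
                    (ψ : Conj L (Fin 4 ⊎ Fin k)) →
                    Holds L C [ four L a₁ a₂ a₃ a₄ , ζ ] ψ → Holds L C [ four L b₁ b₂ b₃ b₄ , ζ ] ψ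
  Holds-four-cong C {ζ} {a₁} {a₂} {a₃} {a₄} {b₁} {b₂} {b₃} {b₄} p₁ p₂ p₃ p₄ ψ =
    to (Holds-cong C ψ pointwise)
    where
      pointwise : ∀ x → [ four L a₁ a₂ a₃ a₄ , ζ ] x ≈[ C ] [ four L b₁ b₂ b₃ b₄ , ζ ] x
      pointwise (inj₁ zero) = p₁
      pointwise (inj₁ (suc zero)) = p₂
      pointwise (inj₁ (suc (suc zero))) = p₃
      pointwise (inj₁ (suc (suc (suc zero)))) = p₄
      pointwise (inj₂ j) = ≈-refl C

  _∘ʰ_ : {A B C : Algebra L} → Hom L B C → Hom L A B → Hom L A C
  _∘ʰ_ {C = C} g f = record
    { fun = fun g ∘ fun f
    ; fun-cong = fun-cong g ∘ fun-cong f
    ; fun-op = λ o a → ≈-trans C (fun-cong g (fun-op f o a)) (fun-op g o (fun f ∘ a))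
    }

  ∘ʰ-embedding : {A B C : Algebra L} {g : Hom L B C} {f : Hom L A B} →
                 IsEmbedding L g → IsEmbedding L f → IsEmbedding L (g ∘ʰ f)
  ∘ʰ-embedding g-emb f-emb = f-emb ∘ g-emb

  retraction⇒embedding : {A B : Algebra L} (ι : Hom L A B) (ε : Hom L B A) →
                         (∀ x → fun ε (fun ι x) ≈[ A ] x) → IsEmbedding L ι
  retraction⇒embedding {A} ι ε ει {x} {y} ιx≈ιy =
    ≈-trans A (≈-sym A (ει x)) (≈-trans A (fun-cong ε ιx≈ιy) (ει y))

  IsCongruence-preimage : {A B : Algebra L} (h : Hom L A B) {θ : Carrier B → Carrier B → Set} →
                          IsCongruence L B θ → IsCongruence L A (λ x y → θ (fun h x) (fun h y))
  IsCongruence-preimage {B = B} h θ-cong = record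
    { isEquivθ = record { refl = θ.refl ; sym = θ.sym ; trans = θ.trans }
    ; ≈⊆θ = ≈⊆θ ∘ fun-cong h
    ; compat = λ o {a} {b} a≈b →
        θ.trans (≈⊆θ (fun-op h o a)) (θ.trans (compat o a≈b) (≈⊆θ (≈-sym B (fun-op h o b))))
    }
    where
      open IsCongruence θ-cong
      module θ = IsEquivalence isEquivθ

  Cg-hom : {A B : Algebra L} (h : Hom L A B) {a₁ a₂ b₁ b₂ : Carrier A} → Cg L A b₁ b₂ a₁ a₂ →
           Cg L B (fun h b₁) (fun h b₂) (fun h a₁) (fun h a₂)
  Cg-hom h cg θ θ-cong = cg _ (IsCongruence-preimage h θ-cong)

  Cg-resp-≈ : {A : Algebra L} {a₁ a₂ b₁ b₂ a₁′ a₂′ b₁′ b₂′ : Carrier A} →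
              a₁ ≈[ A ] a₁′ → a₂ ≈[ A ] a₂′ → b₁ ≈[ A ] b₁′ → b₂ ≈[ A ] b₂′ →
              Cg L A b₁ b₂ a₁ a₂ → Cg L A b₁′ b₂′ a₁′ a₂′
  Cg-resp-≈ {A} {b₁ = b₁} {b₂} a₁≈ a₂≈ b₁≈ b₂≈ cg θ θ-cong θb′ =
    θ.trans (≈⊆θ (≈-sym A a₁≈)) (θ.trans (cg θ θ-cong θb) (≈⊆θ a₂≈))
    where
      open IsCongruence θ-cong
      module θ = IsEquivalence isEquivθ
      θb : θ b₁ b₂
      θb = θ.trans (≈⊆θ b₁≈) (θ.trans θb′ (≈⊆θ (≈-sym A b₂≈)))

  Cg-retract : {A B : Algebra L} (ι : Hom L A B) (ε : Hom L B A) →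
               (∀ x → fun ε (fun ι x) ≈[ A ] x) → {a₁ a₂ b₁ b₂ : Carrier A} →
               Cg L A b₁ b₂ a₁ a₂ ⇔ Cg L B (fun ι b₁) (fun ι b₂) (fun ι a₁) (fun ι a₂)
  Cg-retract ι ε ει = mk⇔ (Cg-hom ι) (Cg-resp-≈ (ει _) (ει _) (ει _) (ει _) ∘ Cg-hom ε)

  module _ (V : Variety L) where

    Model : Algebra L → Set
    Model C = _∈V_ L C V

    infix 4 _⊨_ _⊢_≐_ _⊢*_

    _⊨_ : {X : Set} → Conj L X → Conj L X → Set₁
    π ⊨ Ψ = _⊨_⇒_ L V π Ψ

    data _⊢_≐_ {X : Set} (H : Pred (Equation L X) 0ℓ) : Term L X → Term L X → Set where
      hyp     : ∀ {s t} → H (s , t) → H ⊢ s ≐ t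
      axiom   : ∀ {l r} → Axioms V (l , r) → (σ : ℕ → Term L X) →
                H ⊢ substT L σ l ≐ substT L σ r
      ≐-refl  : ∀ {t} → H ⊢ t ≐ t
      ≐-sym   : ∀ {s t} → H ⊢ s ≐ t → H ⊢ t ≐ s
      ≐-trans : ∀ {s t u} → H ⊢ s ≐ t → H ⊢ t ≐ u → H ⊢ s ≐ u
      ≐-cong  : ∀ o {ss ts : Fin (ar L o) → Term L X} →
                (∀ i → H ⊢ ss i ≐ ts i) → H ⊢ app o ss ≐ app o ts

    _⊢*_ : {X : Set} → Pred (Equation L X) 0ℓ → Conj L X → Set
    H ⊢* Ψ = All (uncurry (H ⊢_≐_)) Ψ

    ⊢-mono : {X : Set} {H H′ : Pred (Equation L X) 0ℓ} → H ⊆ H′ →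
             ∀ {s t} → H ⊢ s ≐ t → H′ ⊢ s ≐ t
    ⊢-mono H⊆H′ (hyp h) = hyp (H⊆H′ h)
    ⊢-mono H⊆H′ (axiom l≈r σ) = axiom l≈r σ
    ⊢-mono H⊆H′ ≐-refl = ≐-refl
    ⊢-mono H⊆H′ (≐-sym d) = ≐-sym (⊢-mono H⊆H′ d)
    ⊢-mono H⊆H′ (≐-trans d e) = ≐-trans (⊢-mono H⊆H′ d) (⊢-mono H⊆H′ e)
    ⊢-mono H⊆H′ (≐-cong o ds) = ≐-cong o (λ i → ⊢-mono H⊆H′ (ds i))

    ⊢-++⇔∪ : {X : Set} {π Γ : Conj L X} {s t : Term L X} →
             (_∈ π ++ Γ) ⊢ s ≐ t ⇔ ((_∈ π) ∪ (_∈ Γ)) ⊢ s ≐ t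
    ⊢-++⇔∪ {π = π} = mk⇔ (⊢-mono (∈-++⁻ π)) (⊢-mono [ ∈-++⁺ˡ , ∈-++⁺ʳ π ])

    TermModel : {X : Set} → Pred (Equation L X) 0ℓ → Algebra L
    TermModel {X} H = record
      { Carrier = Term L X
      ; _≈_ = H ⊢_≐_
      ; isEquiv = record { refl = ≐-refl ; sym = ≐-sym ; trans = ≐-trans }
      ; op = app
      ; op-cong = ≐-cong
      }

    module _ {X : Set} {H : Pred (Equation L X) 0ℓ} where

      eval-TermModel : {Y : Set} (t : Term L Y) (σ : Y → Term L X) →
                       H ⊢ eval (TermModel H) t σ ≐ substT L σ t
      eval-TermModel (var y) σ = ≐-refl
      eval-TermModel (app o ts) σ = ≐-cong o (λ i → eval-TermModel (ts i) σ)

      eval-TermModel-var : (t : Term L X) → H ⊢ eval (TermModel H) t var ≐ t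
      eval-TermModel-var (var x) = ≐-refl
      eval-TermModel-var (app o ts) = ≐-cong o (λ i → eval-TermModel-var (ts i))

      TermModel-model : Model (TermModel H)
      TermModel-model (l , r) l≈r σ =
        ≐-trans (eval-TermModel l σ) (≐-trans (axiom l≈r σ) (≐-sym (eval-TermModel r σ)))

      Holds-TermModel : (Ψ : Conj L X) → Holds L (TermModel H) var Ψ ⇔ H ⊢* Ψ
      Holds-TermModel Ψ =
        mk⇔ (All.map (λ {e} → unevaluated {e})) (All.map (λ {e} → evaluated {e}))
        where
          unevaluated : HoldsE L (TermModel H) var ⊆ uncurry (H ⊢_≐_)
          unevaluated {l , r} d =
            ≐-trans (≐-sym (eval-TermModel-var l)) (≐-trans d (eval-TermModel-var r))
          evaluated : uncurry (H ⊢_≐_) ⊆ HoldsE L (TermModel H) var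
          evaluated {l , r} d =
            ≐-trans (eval-TermModel-var l) (≐-trans d (≐-sym (eval-TermModel-var r)))

      ⊢-sound : (C : Algebra L) → Model C → {ρ : X → Carrier C} → H ⊆ HoldsE L C ρ →
                ∀ {s t} → H ⊢ s ≐ t → eval C s ρ ≈[ C ] eval C t ρ
      ⊢-sound C M H⊨ (hyp h) = H⊨ h
      ⊢-sound C M {ρ} H⊨ (axiom {l} {r} l≈r σ) =
        ≈-trans C (eval-substT C σ ρ l)
          (≈-trans C (M (l , r) l≈r (λ x → eval C (σ x) ρ)) (≈-sym C (eval-substT C σ ρ r)))
      ⊢-sound C M H⊨ ≐-refl = ≈-refl C
      ⊢-sound C M H⊨ (≐-sym d) = ≈-sym C (⊢-sound C M H⊨ d)
      ⊢-sound C M H⊨ (≐-trans d e) = ≈-trans C (⊢-sound C M H⊨ d) (⊢-sound C M H⊨ e)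
      ⊢-sound C M H⊨ (≐-cong o ds) = op-cong C o (λ i → ⊢-sound C M H⊨ (ds i))

      evalHom : (C : Algebra L) → Model C → {ρ : X → Carrier C} → H ⊆ HoldsE L C ρ →
                Hom L (TermModel H) C
      evalHom C M {ρ} H⊨ = record
        { fun = λ t → eval C t ρ
        ; fun-cong = ⊢-sound C M H⊨
        ; fun-op = λ o ts → ≈-refl C
        }

      eval-∘var : {C : Algebra L} (h : Hom L (TermModel H) C) (t : Term L X) →
                  eval C t (fun h ∘ var) ≈[ C ] fun h t
      eval-∘var {C} h t = ≈-trans C (eval-hom h t var) (fun-cong h (eval-TermModel-var t))

      ∘var-satisfies : {C : Algebra L} (h : Hom L (TermModel H) C) → H ⊆ HoldsE L C (fun h ∘ var)
      ∘var-satisfies {C} h {l , r} l≐r =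
        ≈-trans C (eval-∘var h l) (≈-trans C (fun-cong h (hyp l≐r)) (≈-sym C (eval-∘var h r)))

      ⊢-isCongruence : {H′ : Pred (Equation L X) 0ℓ} → H ⊆ H′ →
                       IsCongruence L (TermModel H) (H′ ⊢_≐_)
      ⊢-isCongruence H⊆H′ = record
        { isEquivθ = record { refl = ≐-refl ; sym = ≐-sym ; trans = ≐-trans }
        ; ≈⊆θ = ⊢-mono H⊆H′
        ; compat = ≐-cong
        }

      ⊢-least : {θ : Term L X → Term L X → Set} {H′ : Pred (Equation L X) 0ℓ} →
                IsCongruence L (TermModel H) θ → H′ ⊆ uncurry θ →
                ∀ {s t} → H′ ⊢ s ≐ t → θ s t
      ⊢-least {θ} {H′} θ-cong H′⊆θ = derived
        where
          open IsCongruence θ-cong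
          module θ = IsEquivalence isEquivθ
          derived : ∀ {s t} → H′ ⊢ s ≐ t → θ s t
          derived (hyp h) = H′⊆θ h
          derived (axiom l≈r σ) = ≈⊆θ (axiom l≈r σ)
          derived ≐-refl = θ.refl
          derived (≐-sym d) = θ.sym (derived d)
          derived (≐-trans d e) = θ.trans (derived d) (derived e)
          derived (≐-cong o ds) = compat o (derived ∘ ds)

      Cg-TermModel : {s₁ s₂ t₁ t₂ : Term L X} →
                     Cg L (TermModel H) t₁ t₂ s₁ s₂ ⇔ (H ∪ (_∈ (t₁ , t₂) ∷ [])) ⊢ s₁ ≐ s₂
      Cg-TermModel = mk⇔
        (λ cg → cg _ (⊢-isCongruence inj₁) (hyp (inj₂ (here refl))))
        (λ d θ θ-cong θt →
           ⊢-least θ-cong [ IsCongruence.≈⊆θ θ-cong ∘ hyp , (λ { (here refl) → θt }) ] d)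

    Holds-TermModel-⊎ : {Y Z : Set} {H : Pred (Equation L (Y ⊎ Z)) 0ℓ} (Ψ : Conj L (Y ⊎ Z)) →
                        Holds L (TermModel H) [ var ∘ inj₁ , var ∘ inj₂ ] Ψ ⇔ H ⊢* Ψ
    Holds-TermModel-⊎ {H = H} Ψ = Holds-TermModel Ψ ⇔-∘ Holds-cong (TermModel H) Ψ unsplit
      where
        unsplit : ∀ x → [ var ∘ inj₁ , var ∘ inj₂ ] x ≈[ TermModel H ] var x
        unsplit (inj₁ y) = ≐-refl
        unsplit (inj₂ z) = ≐-refl

    Holds-inst-∘var : {n k : ℕ} {H : Pred (Equation L (Fin n)) 0ℓ} {C : Algebra L}
                      {s₁ s₂ t₁ t₂ : Term L (Fin n)} (h : Hom L (TermModel H) C)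
                      {ζ : Fin k → Carrier C} (ψ : Conj L (Fin 4 ⊎ Fin k)) →
                      Holds L C [ fun h ∘ var , ζ ] (inst L s₁ s₂ t₁ t₂ ψ) ⇔
                      Holds L C [ four L (fun h s₁) (fun h s₂) (fun h t₁) (fun h t₂) , ζ ] ψ
    Holds-inst-∘var {C = C} {s₁} {s₂} {t₁} {t₂} h =
      Holds-inst C s₁ s₂ t₁ t₂ (eval-∘var h s₁) (eval-∘var h s₂) (eval-∘var h t₁) (eval-∘var h t₂)

    module _ {X : Set} where

      ⊢*-sound : {π Ψ : Conj L X} → (_∈ π) ⊢* Ψ → π ⊨ Ψ
      ⊢*-sound ds C M ρ hs = All.map (⊢-sound C M (All.lookup hs)) ds

      ⊨-complete : {π Ψ : Conj L X} → π ⊨ Ψ → (_∈ π) ⊢* Ψ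
      ⊨-complete {π} {Ψ} π⊨Ψ =
        to (Holds-TermModel Ψ)
          (π⊨Ψ (TermModel (_∈ π)) TermModel-model var (from (Holds-TermModel π) (All.tabulate hyp)))

      ⊨⇔⊢ : {π : Conj L X} {s t : Term L X} → π ⊨ (s , t) ∷ [] ⇔ (_∈ π) ⊢ s ≐ t
      ⊨⇔⊢ = mk⇔ (All.head ∘ ⊨-complete) (λ d → ⊢*-sound (d ∷ []))

      ⊨-weaken : {π π′ Ψ : Conj L X} → (_∈ π) ⊆ (_∈ π′) → π ⊨ Ψ → π′ ⊨ Ψ
      ⊨-weaken π⊆π′ π⊨Ψ C M ρ hs = π⊨Ψ C M ρ (anti-mono π⊆π′ hs)

      ⊢-compact-pointwise : {H : Pred (Equation L X) 0ℓ} {m : ℕ} {ss ts : Fin m → Term L X} →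
                            (∀ i → ∃ λ π → All H π × (_∈ π) ⊢ ss i ≐ ts i) →
                            ∃ λ π → All H π × (∀ i → (_∈ π) ⊢ ss i ≐ ts i)
      ⊢-compact-pointwise {m = zero} _ = [] , [] , λ ()
      ⊢-compact-pointwise {m = suc m} ds with ds zero | ⊢-compact-pointwise (ds ∘ suc)
      ... | π₀ , h₀ , d₀ | π₁ , h₁ , d₁ =
        π₀ ++ π₁ , ++⁺ h₀ h₁ , λ { zero → ⊢-mono ∈-++⁺ˡ d₀ ; (suc i) → ⊢-mono (∈-++⁺ʳ π₀) (d₁ i) }

      ⊢-compact : {H : Pred (Equation L X) 0ℓ} {s t : Term L X} →
                  H ⊢ s ≐ t → ∃ λ π → All H π × (_∈ π) ⊢ s ≐ t
      ⊢-compact (hyp h) = _ ∷ [] , h ∷ [] , hyp (here refl)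
      ⊢-compact (axiom l≈r σ) = [] , [] , axiom l≈r σ
      ⊢-compact ≐-refl = [] , [] , ≐-refl
      ⊢-compact (≐-sym d) with ⊢-compact d
      ... | π , hs , d′ = π , hs , ≐-sym d′
      ⊢-compact (≐-trans d e) with ⊢-compact d | ⊢-compact e
      ... | π₀ , h₀ , d₀ | π₁ , h₁ , d₁ =
        π₀ ++ π₁ , ++⁺ h₀ h₁ , ≐-trans (⊢-mono ∈-++⁺ˡ d₀) (⊢-mono (∈-++⁺ʳ π₀) d₁)
      ⊢-compact (≐-cong o ds) with ⊢-compact-pointwise (λ i → ⊢-compact (ds i))
      ... | π , hs , ds′ = π , hs , ≐-cong o ds′

      ⊢*-compact : {H : Pred (Equation L X) 0ℓ} {Ψ : Conj L X} →
                   H ⊢* Ψ → ∃ λ π → All H π × (_∈ π) ⊢* Ψ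
      ⊢*-compact [] = [] , [] , []
      ⊢*-compact (d ∷ ds) with ⊢-compact d | ⊢*-compact ds
      ... | π₀ , h₀ , d₀ | π₁ , h₁ , ds₁ =
        π₀ ++ π₁ , ++⁺ h₀ h₁ , ⊢-mono ∈-++⁺ˡ d₀ ∷ All.map (⊢-mono (∈-++⁺ʳ π₀)) ds₁

      ⊢*-compact-∪ : {P : Pred (Equation L X) 0ℓ} {Γ Ψ : Conj L X} →
                     (P ∪ (_∈ Γ)) ⊢* Ψ → ∃ λ π₀ → All P π₀ × π₀ ++ Γ ⊨ Ψ
      ⊢*-compact-∪ ds with ⊢*-compact ds
      ... | π , hs , ds′ with All-∪-split hs
      ... | π₀ , p₀ , π⊆ = π₀ , p₀ , ⊨-weaken π⊆ (⊢*-sound ds′)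

    -- A finitely generated model is presented by its diagram

    module Presentation (A : Algebra L) (M : Model A) {n : ℕ} (g : Fin n → Carrier A)
             (represent : (a : Carrier A) → Σ (Term L (Fin n)) λ t → a ≈[ A ] eval A t g) where

      Presented : Algebra L
      Presented = TermModel (HoldsE L A g)

      term : Carrier A → Term L (Fin n)
      term = proj₁ ∘ represent

      toPresented : Hom L A Presented
      toPresented = record
        { fun = term
        ; fun-cong = λ {x} {y} x≈y →
            hyp (≈-trans A (≈-sym A (proj₂ (represent x))) (≈-trans A x≈y (proj₂ (represent y))))
        ; fun-op = λ o a →
            hyp (≈-trans A (≈-sym A (proj₂ (represent (op A o a)))) (op-cong A o (proj₂ ∘ represent ∘ a)))
        }

      fromPresented : Hom L Presented A
      fromPresented = evalHom A M (λ t≈u → t≈u)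

      from∘toPresented : ∀ x → fun fromPresented (fun toPresented x) ≈[ A ] x
      from∘toPresented x = ≈-sym A (proj₂ (represent x))

    module _ {k : ℕ} (γ φ : Conj L (Fin 4 ⊎ Fin k)) where

      Extensible : (A : Algebra L) (a₁ a₂ b₁ b₂ : Carrier A) → Set₁
      Extensible A a₁ a₂ b₁ b₂ =
        Σ (Algebra L) λ B → Model B × Σ (Hom L A B) λ e → IsEmbedding L e ×
          Σ (Fin k → Carrier B) λ ζ →
            Holds L B [ four L (fun e a₁) (fun e a₂) (fun e b₁) (fun e b₂) , ζ ] γ

      GuardedValid : (A : Algebra L) (a₁ a₂ b₁ b₂ : Carrier A) → Set₁
      GuardedValid A a₁ a₂ b₁ b₂ =
        (B : Algebra L) → Model B → (h : Hom L A B) → (ζ : Fin k → Carrier B) →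
          Holds L B [ four L (fun h a₁) (fun h a₂) (fun h b₁) (fun h b₂) , ζ ] γ →
          Holds L B [ four L (fun h a₁) (fun h a₂) (fun h b₁) (fun h b₂) , ζ ] φ

      DefinesPrincipalCongruences : Set₁
      DefinesPrincipalCongruences =
        (A : Algebra L) → Model A → FinitelyGenerated L A → (a₁ a₂ b₁ b₂ : Carrier A) →
          Extensible A a₁ a₂ b₁ b₂ × (Cg L A b₁ b₂ a₁ a₂ ⇔ GuardedValid A a₁ a₂ b₁ b₂)

      GuardedEntails : {n : ℕ} → Conj L (Fin n) → (s₁ s₂ t₁ t₂ : Term L (Fin n)) → Set₁
      GuardedEntails {n} π s₁ s₂ t₁ t₂ =
        (C : Algebra L) → Model C → (ρ : Fin n → Carrier C) → Holds L C ρ π →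
          (ζ : Fin k → Carrier C) →
          Holds L C [ ρ , ζ ] (inst L s₁ s₂ t₁ t₂ γ) → Holds L C [ ρ , ζ ] (inst L s₁ s₂ t₁ t₂ φ)

      IsGuardedDeduction : Set₁
      IsGuardedDeduction =
        (n : ℕ) (s₁ s₂ t₁ t₂ : Term L (Fin n)) (π : Conj L (Fin n)) →
          (π ++ (t₁ , t₂) ∷ [] ⊨ (s₁ , s₂) ∷ [] ⇔ GuardedEntails π s₁ s₂ t₁ t₂) ×
          ((σ : Equation L (Fin n)) →
            liftC L {n} {k} π ++ inst L s₁ s₂ t₁ t₂ γ ⊨ liftC L (σ ∷ []) ⇔ π ⊨ σ ∷ [])

      module _ {n : ℕ} {s₁ s₂ t₁ t₂ : Term L (Fin n)} where

        GuardedEntails⇒GuardedValid : {H : Pred (Equation L (Fin n)) 0ℓ} {π : Conj L (Fin n)} →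
                                      All H π → GuardedEntails π s₁ s₂ t₁ t₂ →
                                      GuardedValid (TermModel H) s₁ s₂ t₁ t₂
        GuardedEntails⇒GuardedValid H-π entails B M h ζ =
          to (Holds-inst-∘var h φ)
            ∘ entails B M (fun h ∘ var) (All.map (∘var-satisfies h) H-π) ζ
            ∘ from (Holds-inst-∘var h γ)

        GuardedValid⇒GuardedEntails : {π : Conj L (Fin n)} →
                                      GuardedValid (TermModel (_∈ π)) s₁ s₂ t₁ t₂ →
                                      GuardedEntails π s₁ s₂ t₁ t₂
        GuardedValid⇒GuardedEntails valid C M ρ hs ζ =
          from (Holds-inst-eval C φ)
            ∘ valid C M (evalHom C M (All.lookup hs)) ζ
            ∘ to (Holds-inst-eval C γ)

        liftC-GuardedEntails : {π : Conj L (Fin n)} →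
                               liftC L π ++ inst L s₁ s₂ t₁ t₂ γ ⊨ inst L s₁ s₂ t₁ t₂ φ →
                               GuardedEntails π s₁ s₂ t₁ t₂
        liftC-GuardedEntails {π} entails C M ρ hs ζ hγ =
          entails C M [ ρ , ζ ] (++⁺ (from (Holds-liftC C [ ρ , ζ ] π) hs) hγ)

        deduction-of-Cg : {π : Conj L (Fin n)} →
                          (Cg L (TermModel (_∈ π)) t₁ t₂ s₁ s₂ ⇔
                           GuardedValid (TermModel (_∈ π)) s₁ s₂ t₁ t₂) →
                          π ++ (t₁ , t₂) ∷ [] ⊨ (s₁ , s₂) ∷ [] ⇔ GuardedEntails π s₁ s₂ t₁ t₂
        deduction-of-Cg {π} Cg⇔valid = begin
          π ++ (t₁ , t₂) ∷ [] ⊨ (s₁ , s₂) ∷ []        ∼⟨ ⊨⇔⊢ ⟩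
          (_∈ π ++ (t₁ , t₂) ∷ []) ⊢ s₁ ≐ s₂          ∼⟨ ⊢-++⇔∪ ⟩
          ((_∈ π) ∪ (_∈ (t₁ , t₂) ∷ [])) ⊢ s₁ ≐ s₂   ∼⟨ ⇔-sym Cg-TermModel ⟩
          Cg L (TermModel (_∈ π)) t₁ t₂ s₁ s₂         ∼⟨ Cg⇔valid ⟩
          GuardedValid (TermModel (_∈ π)) s₁ s₂ t₁ t₂ ∼⟨ valid⇔entails ⟩
          GuardedEntails π s₁ s₂ t₁ t₂                ∎
          where
            open EquationalReasoning
            valid⇔entails : GuardedValid (TermModel (_∈ π)) s₁ s₂ t₁ t₂ ⇔ GuardedEntails π s₁ s₂ t₁ t₂
            valid⇔entails =
              mk⇔ GuardedValid⇒GuardedEntails (GuardedEntails⇒GuardedValid (All.tabulate (λ m → m)))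

        conservativity : {π : Conj L (Fin n)} → Extensible (TermModel (_∈ π)) s₁ s₂ t₁ t₂ →
                         (σ : Equation L (Fin n)) →
                         liftC L {n} {k} π ++ inst L s₁ s₂ t₁ t₂ γ ⊨ liftC L (σ ∷ []) ⇔ π ⊨ σ ∷ []
        conservativity {π} (B , M , e , e-emb , ζ , hγ) (l , r) = mk⇔ restrict extend
          where
            premises : Holds L B [ fun e ∘ var , ζ ] (liftC L π ++ inst L s₁ s₂ t₁ t₂ γ)
            premises = ++⁺ (from (Holds-liftC B _ π) (All.tabulate (∘var-satisfies e)))
                           (from (Holds-inst-∘var e γ) hγ)
            restrict : liftC L π ++ inst L s₁ s₂ t₁ t₂ γ ⊨ liftC L ((l , r) ∷ []) → π ⊨ (l , r) ∷ []
            restrict entails = ⊢*-sound (e-emb el≈er ∷ [])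
              where
                el≈er : fun e l ≈[ B ] fun e r
                el≈er = ≈-trans B (≈-sym B (eval-∘var e l))
                          (≈-trans B (All.head (to (Holds-liftC B _ ((l , r) ∷ []))
                                                   (entails B M _ premises)))
                                     (eval-∘var e r))
            extend : π ⊨ (l , r) ∷ [] → liftC L π ++ inst L s₁ s₂ t₁ t₂ γ ⊨ liftC L ((l , r) ∷ [])
            extend entails C M ρ hs =
              from (Holds-liftC C ρ ((l , r) ∷ []))
                (entails C M (ρ ∘ inj₁) (to (Holds-liftC C ρ π) (++⁻ˡ (liftC L π) hs)))

      guardedDeduction : DefinesPrincipalCongruences → IsGuardedDeduction
      guardedDeduction principal n s₁ s₂ t₁ t₂ π =
        deduction-of-Cg (proj₂ P-principal) , conservativity (proj₁ P-principal)
        where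
          P-generated : FinitelyGenerated L (TermModel (_∈ π))
          P-generated = n , var , λ t → t , ≐-sym (eval-TermModel-var t)
          P-principal : Extensible (TermModel (_∈ π)) s₁ s₂ t₁ t₂ ×
                        (Cg L (TermModel (_∈ π)) t₁ t₂ s₁ s₂ ⇔
                         GuardedValid (TermModel (_∈ π)) s₁ s₂ t₁ t₂)
          P-principal = principal (TermModel (_∈ π)) TermModel-model P-generated s₁ s₂ t₁ t₂

      module _ {A P : Algebra L} (ι : Hom L A P) (ε : Hom L P A)
               (ει : ∀ x → fun ε (fun ι x) ≈[ A ] x) {a₁ a₂ b₁ b₂ : Carrier A} where

        Extensible-retract : Extensible P (fun ι a₁) (fun ι a₂) (fun ι b₁) (fun ι b₂) →
                             Extensible A a₁ a₂ b₁ b₂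
        Extensible-retract (B , M , e , e-emb , ζ , hγ) =
          B , M , e ∘ʰ ι , ∘ʰ-embedding {g = e} {f = ι} e-emb (retraction⇒embedding ι ε ει) , ζ , hγ

        GuardedValid-retract : GuardedValid P (fun ι a₁) (fun ι a₂) (fun ι b₁) (fun ι b₂) ⇔
                               GuardedValid A a₁ a₂ b₁ b₂
        GuardedValid-retract = mk⇔ pull (λ valid B M h → valid B M (h ∘ʰ ι))
          where
            pull : GuardedValid P (fun ι a₁) (fun ι a₂) (fun ι b₁) (fun ι b₂) →
                   GuardedValid A a₁ a₂ b₁ b₂
            pull valid B M h ζ =
              Holds-four-cong B (hει a₁) (hει a₂) (hει b₁) (hει b₂) φ
                ∘ valid B M (h ∘ʰ ε) ζ
                ∘ Holds-four-cong B (≈-sym B (hει a₁)) (≈-sym B (hει a₂))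
                                    (≈-sym B (hει b₁)) (≈-sym B (hει b₂)) γ
              where
                hει : ∀ x → fun h (fun ε (fun ι x)) ≈[ B ] fun h x
                hει x = fun-cong h (ει x)

        principal-retract :
          Extensible P (fun ι a₁) (fun ι a₂) (fun ι b₁) (fun ι b₂) ×
            (Cg L P (fun ι b₁) (fun ι b₂) (fun ι a₁) (fun ι a₂) ⇔
             GuardedValid P (fun ι a₁) (fun ι a₂) (fun ι b₁) (fun ι b₂)) →
          Extensible A a₁ a₂ b₁ b₂ × (Cg L A b₁ b₂ a₁ a₂ ⇔ GuardedValid A a₁ a₂ b₁ b₂)
        principal-retract (extensible , Cg⇔valid) =
          Extensible-retract extensible ,
          GuardedValid-retract ⇔-∘ (Cg⇔valid ⇔-∘ Cg-retract ι ε ει)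

      module GenericExtension (deduction : IsGuardedDeduction) {n : ℕ}
                              (H : Pred (Equation L (Fin n)) 0ℓ) (s₁ s₂ t₁ t₂ : Term L (Fin n)) where

        Γ Φ : Conj L (Fin n ⊎ Fin k)
        Γ = inst L s₁ s₂ t₁ t₂ γ
        Φ = inst L s₁ s₂ t₁ t₂ φ

        Lifted : Pred (Equation L (Fin n ⊎ Fin k)) 0ℓ
        Lifted e = ∃ λ e₀ → H e₀ × e ≡ substE L (var ∘ inj₁) e₀

        B : Algebra L
        B = TermModel (Lifted ∪ (_∈ Γ))

        embed : Hom L (TermModel H) B
        embed = evalHom B TermModel-model lifted
          where
            lifted : H ⊆ HoldsE L B (var ∘ inj₁)
            lifted {l , r} h =
              ≐-trans (eval-TermModel l _)
                (≐-trans (hyp (inj₁ ((l , r) , h , refl))) (≐-sym (eval-TermModel r _)))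

        B-guarded : Holds L B [ four L (fun embed s₁) (fun embed s₂) (fun embed t₁) (fun embed t₂)
                              , var ∘ inj₂ ] γ
        B-guarded = to (Holds-inst-eval B γ) (from (Holds-TermModel-⊎ Γ) (All.tabulate (hyp ∘ inj₂)))

        B-compact : {Ψ : Conj L (Fin n ⊎ Fin k)} → (Lifted ∪ (_∈ Γ)) ⊢* Ψ →
                    ∃ λ π₀ → All H π₀ × liftC L π₀ ++ Γ ⊨ Ψ
        B-compact {Ψ} ds with ⊢*-compact-∪ ds
        ... | π , hs , entails with All-preimage hs
        ... | π₀ , h₀ , π≡ = π₀ , h₀ , subst (λ π → π ++ Γ ⊨ Ψ) π≡ entails

        embed-isEmbedding : IsEmbedding L embed
        embed-isEmbedding {x} {y} ex≈ey with B-compact {liftC L ((x , y) ∷ [])} (lifted ∷ [])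
          where
            lifted : (Lifted ∪ (_∈ Γ)) ⊢ substT L (var ∘ inj₁) x ≐ substT L (var ∘ inj₁) y
            lifted = ≐-trans (≐-sym (eval-TermModel x _)) (≐-trans ex≈ey (eval-TermModel y _))
        ... | π₀ , h₀ , entails =
          ⊢-mono (All.lookup h₀) (to ⊨⇔⊢ (to (proj₂ (deduction n s₁ s₂ t₁ t₂ π₀) (x , y)) entails))

        extensible : Extensible (TermModel H) s₁ s₂ t₁ t₂
        extensible = B , TermModel-model , embed , embed-isEmbedding , var ∘ inj₂ , B-guarded

        Cg⇔GuardedValid : Cg L (TermModel H) t₁ t₂ s₁ s₂ ⇔ GuardedValid (TermModel H) s₁ s₂ t₁ t₂
        Cg⇔GuardedValid = mk⇔ valid derivable ⇔-∘ Cg-TermModel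
          where
            valid : (H ∪ (_∈ (t₁ , t₂) ∷ [])) ⊢ s₁ ≐ s₂ → GuardedValid (TermModel H) s₁ s₂ t₁ t₂
            valid d with ⊢*-compact-∪ (d ∷ [])
            ... | π₀ , h₀ , entails =
              GuardedEntails⇒GuardedValid h₀ (to (proj₁ (deduction n s₁ s₂ t₁ t₂ π₀)) entails)
            valid⇒⊢Φ : GuardedValid (TermModel H) s₁ s₂ t₁ t₂ → (Lifted ∪ (_∈ Γ)) ⊢* Φ
            valid⇒⊢Φ valid =
              to (Holds-TermModel-⊎ Φ)
                (from (Holds-inst-eval B φ) (valid B TermModel-model embed (var ∘ inj₂) B-guarded))
            derivable : GuardedValid (TermModel H) s₁ s₂ t₁ t₂ → (H ∪ (_∈ (t₁ , t₂) ∷ [])) ⊢ s₁ ≐ s₂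
            derivable valid with B-compact (valid⇒⊢Φ valid)
            ... | π₀ , h₀ , entails =
              ⊢-mono (λ m → map₁ (All.lookup h₀) m)
                (to ⊢-++⇔∪ (to ⊨⇔⊢ (from (proj₁ (deduction n s₁ s₂ t₁ t₂ π₀))
                                            (liftC-GuardedEntails entails))))

      principalCongruences : IsGuardedDeduction → DefinesPrincipalCongruences
      principalCongruences deduction A M (n , g , represent) a₁ a₂ b₁ b₂ =
        principal-retract toPresented fromPresented from∘toPresented
          (extensible (term a₁) (term a₂) (term b₁) (term b₂) ,
           Cg⇔GuardedValid (term a₁) (term a₂) (term b₁) (term b₂))
        where
          open Presentation A M g represent
          open GenericExtension deduction (HoldsE L A g)

proposition5p5 : (L : Language) → HasConstant L → (V : Variety L) →
                   GuardedDeductionTheorem L V ⇔ Condition2 L V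
proposition5p5 L _ V = mk⇔
  (λ (k , γ , φ , deduction) → k , γ , φ , principalCongruences L V γ φ deduction)
  (λ (k , γ , φ , principal) → k , γ , φ , guardedDeduction L V γ φ principal)
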